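{- Let $k$ be a positive odd integer. Then there exists a tournament $T$ such that $M_T=\{0\}\cup\{m^2: m \text{ odd},\ 1\le m\le k\}=\{0,1^2,3^2,\dots,k^2\}$, where $M_T$ is the set of determinants of all subtournaments of $T$.
   Context: A tournament is a directed graph with exactly one arc between each pair of distinct vertices. For a tournament $T$ on vertices $v_1,\dots,v_n$, its skew-adjacency matrix is the zero-diagonal matrix $S_T=[s_{ij}]$ with $s_{ij}=-s_{ji}=1$ if there is an arc from $v_i$ to $v_j$, and $\det(T):=\det(S_T)$. A subtournament of $T$ is the tournament induced by a nonempty subset of $V(T)$ (including $T$ itself). -}

module Defs where

open import Data.Nat using (ℕ; zero; suc) renaming (_*_ to _*ℕ_)
open import Data.Product using (Σ)
open import Data.Fin using (Fin; zero; suc; punchIn; _<_)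
open import Data.Bool using (Bool; true; false; not)
open import Data.Integer using (ℤ; +_; -_; _+_; _*_)
open import Relation.Binary.PropositionalEquality using (_≡_; _≢_)
open import Relation.Nullary using (¬_)
open import Data.Fin.Properties using (<-cmp; <-irrefl)
open import Relation.Binary.Definitions using (tri<; tri≈; tri>)
open import Relation.Binary.PropositionalEquality using (refl; sym; subst)

record Tournament (n : ℕ) : Set where
  field
    arc       : Fin n → Fin n → Bool
    irrefl    : ∀ i → arc i i ≡ false
    exactlyOne : ∀ i j → i ≢ j → arc j i ≡ not (arc i j)
open Tournament public

Matrix : ℕ → Set
Matrix n = Fin n → Fin n → ℤ

∑ : ∀ {n} → (Fin n → ℤ) → ℤ
∑ {zero}  f = + 0
∑ {suc n} f = f zero + ∑ (λ i → f (suc i))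

sgn : ∀ {n} → Fin n → ℤ
sgn zero    = + 1
sgn (suc j) = - sgn j

det : ∀ {n} → Matrix n → ℤ
det {zero}  A = + 1
det {suc n} A = ∑ (λ j → sgn j * (A zero j * det (λ r c → A (suc r) (punchIn j c))))

skew : ∀ {n} → Tournament n → Matrix n
skew T i j with arc T i j | arc T j i
... | true  | _     = + 1
... | false | true  = - (+ 1)
... | false | false = + 0

detT : ∀ {n} → Tournament n → ℤ
detT T = det (skew T)

-- A choice of m vertices of Fin n, listed in increasing order
-- (i.e. an m-element subset of the vertex set).
record VertexSubset (n m : ℕ) : Set where
  field
    elem : Fin m → Fin n
    increasing : ∀ i j → i < j → elem i < elem j
open VertexSubset public

elem-inj : ∀ {n m} (S : VertexSubset n m) (i j : Fin m) → elem S i ≡ elem S j → i ≡ j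
elem-inj S i j e with <-cmp i j
... | tri< i<j _ _ = contradiction' (subst (λ x → elem S i < x) (sym e) (increasing S i j i<j))
  where
  contradiction' : elem S i < elem S i → i ≡ j
  contradiction' p with <-irrefl refl p
  ... | ()
... | tri≈ _ i≡j _ = i≡j
... | tri> _ _ j<i = contradiction' (subst (λ x → elem S j < x) e (increasing S j i j<i))
  where
  contradiction' : elem S j < elem S j → i ≡ j
  contradiction' p with <-irrefl refl p
  ... | ()

induced : ∀ {n m} → Tournament n → VertexSubset n m → Tournament m
induced T S = record
  { arc = λ i j → arc T (elem S i) (elem S j)
  ; irrefl = λ i → irrefl T (elem S i)
  ; exactlyOne = λ i j i≢j → exactlyOne T (elem S i) (elem S j)
      (λ e → i≢j (elem-inj S i j e))
  }

-- M_T: z ∈ M_T iff z is the determinant of some subtournament of T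
-- induced by a nonempty vertex subset.
InM : ∀ {n} → Tournament n → ℤ → Set
InM {n} T z = Σ ℕ (λ m → Σ (VertexSubset n (suc m)) (λ S → detT (induced T S) ≡ z))

Odd : ℕ → Set
Odd m = Σ ℕ (λ j → m ≡ suc (2 *ℕ j))

module Submission where

-- Let T be the tournament on 0, 1, …, k in which 1, …, k are ordered transitively and 0 beats
-- exactly the odd-numbered vertices 1, 3, 5, ….  In every subtournament the vertices after the first
-- are again ordered transitively, so the skew matrix of a subtournament on m + 1 vertices is a
-- transitive skew matrix of size m bordered by a sign vector ε and by -ε.  Two row operations and an expansion give a recurrence for such
-- bordered determinants, whose solution is 0 for m even and (ε₁ - ε₂ + ε₃ - ⋯)² for m odd.  An
-- alternating sum of an odd number m of signs is odd of absolute value at most m, and on the first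
-- m + 1 vertices the signs alternate, which gives exactly m².

open import Defs
open import Algebra.Properties.AbelianGroup using (inverseˡ-unique)
open import Data.Bool using (Bool; true; false; not)
open import Data.Bool.Properties using (not-involutive)
open import Data.Fin using (Fin; zero; suc; punchIn; punchOut; inject≤; _≟_; _<_)
open import Data.Fin.Properties
  using (punchInᵢ≢i; punchOut-cong; punchOut-punchIn; suc-injective; <-cmp; toℕ-inject≤; injective⇒≤)
open import Data.Integer using (ℤ; +_; 0ℤ; 1ℤ; -1ℤ; -_; _+_; _-_; _*_)
open import Data.Integer.Properties
  using (+-*-semiring; +-0-abelianGroup; -1*i≡-i; +-identityˡ; +-identityʳ; neg-involutive; pos-*; *-assoc; *-zeroʳ)
open import Data.Integer.Tactic.RingSolver using (solve-∀)
open import Data.Nat as ℕ using (ℕ; zero; suc; parity; _≤_; z≤n; s≤s; s≤s⁻¹)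
open import Data.Nat.Properties using (≤-refl; ≤-trans; ≤-reflexive; m≤n+m; +-suc)
open import Data.Parity.Base using (Parity; 0ℙ; 1ℙ; _⁻¹)
open import Data.Parity.Properties using (suc-homo-⁻¹; ⁻¹-selfInverse; *-homo-*)
open import Data.Product using (Σ; _×_; _,_)
open import Data.Sum using (_⊎_; inj₁; inj₂)
open import Data.Vec.Functional using (Vector; _∷_; head; tail; map; zipWith; removeAt)
open import Function using (_∘_)
open import Relation.Binary.Definitions using (tri<; tri≈; tri>)
open import Relation.Binary.PropositionalEquality
open import Relation.Nullary using (yes; no; contradiction)

open import Algebra.Properties.Semiring.Sum +-*-semiring
  using (sum; sum-cong-≗; sum-remove; sum-replicate-zero; ∑-comm; ∑-distrib-+; *-distribˡ-sum)
open ≡-Reasoning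

∑≡sum : ∀ {n} (f : Fin n → ℤ) → ∑ f ≡ sum f
∑≡sum {zero}  f = refl
∑≡sum {suc n} f = cong (_+_ (f zero)) (∑≡sum (f ∘ suc))

neg-distrib-sum : ∀ {n} (f : Vector ℤ n) → - sum f ≡ sum (map -_ f)
neg-distrib-sum f = begin
  - sum f              ≡⟨ -1*i≡-i (sum f) ⟨
  -1ℤ * sum f          ≡⟨ *-distribˡ-sum -1ℤ f ⟩
  sum (map (-1ℤ *_) f) ≡⟨ sum-cong-≗ (-1*i≡-i ∘ f) ⟩
  sum (map -_ f)       ∎

sum-zero : ∀ {n} (f : Vector ℤ n) → (∀ i → f i ≡ 0ℤ) → sum f ≡ 0ℤ
sum-zero {n} f f≗0 = trans (sum-cong-≗ f≗0) (sum-replicate-zero n)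

i≡-i⇒i≡0 : ∀ {i} → i ≡ - i → i ≡ 0ℤ
i≡-i⇒i≡0 {+ 0} _ = refl

sum-antisymmetric : ∀ {n} (F : Fin n → Fin n → ℤ) → (∀ x y → F x y ≡ - F y x) →
                    sum (λ x → sum (F x)) ≡ 0ℤ
sum-antisymmetric {n} F antisym = i≡-i⇒i≡0 (begin
  sum (λ x → sum (F x))           ≡⟨ ∑-comm F ⟩
  sum (λ y → sum (λ x → F x y))   ≡⟨ sum-cong-≗ (λ y → sum-cong-≗ (λ x → antisym x y)) ⟩
  sum (λ y → sum (λ x → - F y x)) ≡⟨ sum-cong-≗ (λ y → neg-distrib-sum (F y)) ⟨
  sum (λ y → - sum (F y))         ≡⟨ neg-distrib-sum {n} _ ⟨
  - sum (λ x → sum (F x))         ∎)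

-- Laplace expansion and row operations

Rows : ℕ → ℕ → Set
Rows m n = Vector (Vector ℤ n) m

removeCol : ∀ {m n} → Fin (suc n) → Rows m (suc n) → Rows m n
removeCol j B r = removeAt (B r) j

∑-cong : ∀ {n} {f g : Fin n → ℤ} → (∀ i → f i ≡ g i) → ∑ f ≡ ∑ g
∑-cong {f = f} {g} f≗g = trans (∑≡sum f) (trans (sum-cong-≗ f≗g) (sym (∑≡sum g)))

det-cong : ∀ {n} (A B : Matrix n) → (∀ i j → A i j ≡ B i j) → det A ≡ det B
det-cong {zero}  A B A≗B = refl
det-cong {suc n} A B A≗B = ∑-cong λ j → cong (sgn j *_) (cong₂ _*_ (A≗B zero j)
  (det-cong (removeCol j (A ∘ suc)) (removeCol j (B ∘ suc)) λ r c → A≗B (suc r) (punchIn j c)))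

det-expand : ∀ {n} (u : Vector ℤ (suc n)) (B : Rows n (suc n)) →
             det (u ∷ B) ≡ sum (λ j → sgn j * (u j * det (removeCol j B)))
det-expand u B = ∑≡sum (λ j → sgn j * (u j * det (removeCol j B)))

det-removeCol-∷ : ∀ {n} j (u : Vector ℤ (suc (suc n))) (B : Rows n (suc (suc n))) →
                  det (removeCol j (u ∷ B)) ≡ det (removeAt u j ∷ removeCol j B)
det-removeCol-∷ j u B =
  det-cong (removeCol j (u ∷ B)) (removeAt u j ∷ removeCol j B) λ { zero c → refl ; (suc r) c → refl }

det-linear-row₀ : ∀ {n} (u v : Vector ℤ (suc n)) (B : Rows n (suc n)) →
                  det (zipWith _+_ u v ∷ B) ≡ det (u ∷ B) + det (v ∷ B)
det-linear-row₀ {n} u v B = begin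
  det (zipWith _+_ u v ∷ B)
    ≡⟨ det-expand (zipWith _+_ u v) B ⟩
  sum (λ j → sgn j * ((u j + v j) * M j))
    ≡⟨ sum-cong-≗ (λ j → distrib (sgn j) (u j) (v j) (M j)) ⟩
  sum (λ j → sgn j * (u j * M j) + sgn j * (v j * M j))
    ≡⟨ ∑-distrib-+ (λ j → sgn j * (u j * M j)) (λ j → sgn j * (v j * M j)) ⟩
  sum (λ j → sgn j * (u j * M j)) + sum (λ j → sgn j * (v j * M j))
    ≡⟨ cong₂ _+_ (det-expand u B) (det-expand v B) ⟨
  det (u ∷ B) + det (v ∷ B) ∎
  where
  M : Fin (suc n) → ℤ
  M j = det (removeCol j B)
  distrib : ∀ s x y d → s * ((x + y) * d) ≡ s * (x * d) + s * (y * d)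
  distrib = solve-∀

det-linear-row₁ : ∀ {n} (u v w : Vector ℤ (suc (suc n))) (B : Rows n (suc (suc n))) →
                  det (u ∷ zipWith _+_ v w ∷ B) ≡ det (u ∷ v ∷ B) + det (u ∷ w ∷ B)
det-linear-row₁ {n} u v w B = begin
  det (u ∷ zipWith _+_ v w ∷ B)
    ≡⟨ det-expand u (zipWith _+_ v w ∷ B) ⟩
  sum (λ j → sgn j * (u j * det (removeCol j (zipWith _+_ v w ∷ B))))
    ≡⟨ sum-cong-≗ (λ j → cong (λ d → sgn j * (u j * d)) (minor j)) ⟩
  sum (λ j → sgn j * (u j * (M v j + M w j)))
    ≡⟨ sum-cong-≗ (λ j → distrib (sgn j) (u j) (M v j) (M w j)) ⟩
  sum (λ j → sgn j * (u j * M v j) + sgn j * (u j * M w j))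
    ≡⟨ ∑-distrib-+ (λ j → sgn j * (u j * M v j)) (λ j → sgn j * (u j * M w j)) ⟩
  sum (λ j → sgn j * (u j * M v j)) + sum (λ j → sgn j * (u j * M w j))
    ≡⟨ cong₂ _+_ (det-expand u (v ∷ B)) (det-expand u (w ∷ B)) ⟨
  det (u ∷ v ∷ B) + det (u ∷ w ∷ B) ∎
  where
  M : Vector ℤ (suc (suc n)) → Fin (suc (suc n)) → ℤ
  M x j = det (removeCol j (x ∷ B))
  minor : ∀ j → M (zipWith _+_ v w) j ≡ M v j + M w j
  minor j = begin
    M (zipWith _+_ v w) j
      ≡⟨ det-removeCol-∷ j (zipWith _+_ v w) B ⟩
    det (zipWith _+_ (removeAt v j) (removeAt w j) ∷ removeCol j B)
      ≡⟨ det-linear-row₀ (removeAt v j) (removeAt w j) (removeCol j B) ⟩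
    det (removeAt v j ∷ removeCol j B) + det (removeAt w j ∷ removeCol j B)
      ≡⟨ cong₂ _+_ (det-removeCol-∷ j v B) (det-removeCol-∷ j w B) ⟨
    M v j + M w j ∎
  distrib : ∀ s x d e → s * (x * (d + e)) ≡ s * (x * d) + s * (x * e)
  distrib = solve-∀

sgn-punchOut : ∀ {n} {i j : Fin (suc n)} (i≢j : i ≢ j) (j≢i : j ≢ i) →
               sgn i * sgn (punchOut i≢j) ≡ - (sgn j * sgn (punchOut j≢i))
sgn-punchOut {_}     {zero}  {zero}  i≢j _ = contradiction refl i≢j
sgn-punchOut {suc n} {zero}  {suc j} _   _ = sgn-swap (sgn j)
  where
  sgn-swap : ∀ s → 1ℤ * s ≡ - (- s * 1ℤ)
  sgn-swap = solve-∀
sgn-punchOut {suc n} {suc i} {zero}  _   _ = sgn-swap (sgn i)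
  where
  sgn-swap : ∀ s → - s * 1ℤ ≡ - (1ℤ * s)
  sgn-swap = solve-∀
sgn-punchOut {suc n} {suc i} {suc j} i≢j j≢i = begin
  - sgn i * - sgn (punchOut (i≢j ∘ cong suc))    ≡⟨ neg-cancel (sgn i) _ ⟩
  sgn i * sgn (punchOut (i≢j ∘ cong suc))        ≡⟨ sgn-punchOut (i≢j ∘ cong suc) (j≢i ∘ cong suc) ⟩
  - (sgn j * sgn (punchOut (j≢i ∘ cong suc)))    ≡⟨ cong -_ (neg-cancel (sgn j) _) ⟨
  - (- sgn j * - sgn (punchOut (j≢i ∘ cong suc))) ∎
  where
  neg-cancel : ∀ a b → - a * - b ≡ a * b
  neg-cancel = solve-∀

punchIn-punchOut-comm : ∀ {n} {i j : Fin (suc (suc n))} (i≢j : i ≢ j) (j≢i : j ≢ i) (k : Fin n) →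
                        punchIn i (punchIn (punchOut i≢j) k) ≡ punchIn j (punchIn (punchOut j≢i) k)
punchIn-punchOut-comm {_}     {zero}  {zero}  i≢j _   k       = contradiction refl i≢j
punchIn-punchOut-comm {_}     {zero}  {suc j} _   _   k       = refl
punchIn-punchOut-comm {_}     {suc i} {zero}  _   _   k       = refl
punchIn-punchOut-comm {suc n} {suc i} {suc j} _   _   zero    = refl
punchIn-punchOut-comm {suc n} {suc i} {suc j} i≢j j≢i (suc k) =
  cong suc (punchIn-punchOut-comm (i≢j ∘ cong suc) (j≢i ∘ cong suc) k)

-- Expanding twice writes det (u ∷ u ∷ B) as a double sum over pairs of distinct columns x, y
-- whose summand G x y is antisymmetric in (x, y).
det-same-row₀₁ : ∀ {n} (u : Vector ℤ (suc (suc n))) (B : Rows n (suc (suc n))) → det (u ∷ u ∷ B) ≡ 0ℤ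
det-same-row₀₁ {n} u B = begin
  det (u ∷ u ∷ B)                                         ≡⟨ det-expand u (u ∷ B) ⟩
  sum (λ x → sgn x * (u x * det (removeCol x (u ∷ B)))) ≡⟨ sum-cong-≗ expand ⟩
  sum (λ x → sum (G x))                                   ≡⟨ sum-antisymmetric G G-antisym ⟩
  0ℤ                                                      ∎
  where
  minor₂ : ∀ {x y : Fin (suc (suc n))} → x ≢ y → ℤ
  minor₂ {x} x≢y = det (removeCol (punchOut x≢y) (removeCol x B))

  G : Fin (suc (suc n)) → Fin (suc (suc n)) → ℤ
  G x y with x ≟ y
  ... | yes _   = 0ℤ
  ... | no x≢y = sgn x * sgn (punchOut x≢y) * (u x * u y * minor₂ x≢y)

  G-antisym : ∀ x y → G x y ≡ - G y x
  G-antisym x y with x ≟ y | y ≟ x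
  ... | yes _   | yes _   = refl
  ... | yes x≡y | no y≢x = contradiction (sym x≡y) y≢x
  ... | no x≢y | yes y≡x = contradiction (sym y≡x) x≢y
  ... | no x≢y | no y≢x = begin
    sgn x * sgn (punchOut x≢y) * (u x * u y * minor₂ x≢y)
      ≡⟨ cong₂ (λ s d → s * (u x * u y * d)) (sgn-punchOut x≢y y≢x) same-minor ⟩
    - (sgn y * sgn (punchOut y≢x)) * (u x * u y * minor₂ y≢x)
      ≡⟨ rearrange (sgn y * sgn (punchOut y≢x)) (u x) (u y) (minor₂ y≢x) ⟩
    - (sgn y * sgn (punchOut y≢x) * (u y * u x * minor₂ y≢x)) ∎
    where
    same-minor : minor₂ x≢y ≡ minor₂ y≢x
    same-minor = det-cong _ _ λ r c → cong (B r) (punchIn-punchOut-comm x≢y y≢x c)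
    rearrange : ∀ s a b d → - s * (a * b * d) ≡ - (s * (b * a * d))
    rearrange = solve-∀

  G-punchIn : ∀ x k → G x (punchIn x k) ≡
              sgn x * u x * (sgn k * (u (punchIn x k) * det (removeCol k (removeCol x B))))
  G-punchIn x k with x ≟ punchIn x k
  ... | yes x≡ = contradiction (sym x≡) (punchInᵢ≢i x k)
  ... | no x≢
    rewrite trans (punchOut-cong x {i≢j = x≢} {i≢k = punchInᵢ≢i x k ∘ sym} refl) (punchOut-punchIn x {k})
    = rearrange (sgn x) (sgn k) (u x) (u (punchIn x k)) _
    where
    rearrange : ∀ s t a b d → s * t * (a * b * d) ≡ s * a * (t * (b * d))
    rearrange = solve-∀

  expand : ∀ x → sgn x * (u x * det (removeCol x (u ∷ B))) ≡ sum (G x)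
  expand x = begin
    sgn x * (u x * det (removeCol x (u ∷ B)))
      ≡⟨ cong (λ d → sgn x * (u x * d))
              (trans (det-removeCol-∷ x u B) (det-expand (removeAt u x) (removeCol x B))) ⟩
    sgn x * (u x * sum T)                    ≡⟨ *-assoc (sgn x) (u x) (sum T) ⟨
    sgn x * u x * sum T                      ≡⟨ *-distribˡ-sum (sgn x * u x) T ⟩
    sum (λ k → sgn x * u x * T k)            ≡⟨ sum-cong-≗ (G-punchIn x) ⟨
    sum (removeAt (G x) x)                   ≡⟨ +-identityˡ _ ⟨
    0ℤ + sum (removeAt (G x) x)              ≡⟨ cong (_+ sum (removeAt (G x) x)) (i≡-i⇒i≡0 (G-antisym x x)) ⟨
    G x x + sum (removeAt (G x) x)           ≡⟨ sum-remove (G x) ⟨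
    sum (G x)                                ∎
    where
    T : Fin (suc n) → ℤ
    T k = sgn k * (u (punchIn x k) * det (removeCol k (removeCol x B)))

det-swap-row₀₁ : ∀ {n} (u v : Vector ℤ (suc (suc n))) (B : Rows n (suc (suc n))) →
                 det (u ∷ v ∷ B) ≡ - det (v ∷ u ∷ B)
det-swap-row₀₁ u v B = inverseˡ-unique +-0-abelianGroup (det (u ∷ v ∷ B)) (det (v ∷ u ∷ B)) (begin
  det (u ∷ v ∷ B) + det (v ∷ u ∷ B)
    ≡⟨ cong₂ _+_ (+-identityˡ (det (u ∷ v ∷ B))) (+-identityʳ (det (v ∷ u ∷ B))) ⟨
  (0ℤ + det (u ∷ v ∷ B)) + (det (v ∷ u ∷ B) + 0ℤ)
    ≡⟨ cong₂ (λ a b → (a + det (u ∷ v ∷ B)) + (det (v ∷ u ∷ B) + b))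
             (det-same-row₀₁ u B) (det-same-row₀₁ v B) ⟨
  (det (u ∷ u ∷ B) + det (u ∷ v ∷ B)) + (det (v ∷ u ∷ B) + det (v ∷ v ∷ B))
    ≡⟨ cong₂ _+_ (det-linear-row₁ u u v B) (det-linear-row₁ v u v B) ⟨
  det (u ∷ w ∷ B) + det (v ∷ w ∷ B)
    ≡⟨ det-linear-row₀ u v (w ∷ B) ⟨
  det (w ∷ w ∷ B)
    ≡⟨ det-same-row₀₁ w B ⟩
  0ℤ ∎)
  where
  w = zipWith _+_ u v

det-same-row₁₂ : ∀ {n} (u v : Vector ℤ (suc (suc (suc n)))) (B : Rows n (suc (suc (suc n)))) →
                 det (u ∷ v ∷ v ∷ B) ≡ 0ℤ
det-same-row₁₂ u v B = trans (det-expand u (v ∷ v ∷ B)) (sum-zero _ λ j → begin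
  sgn j * (u j * det (removeCol j (v ∷ v ∷ B)))
    ≡⟨ cong (λ d → sgn j * (u j * d))
            (det-cong (removeCol j (v ∷ v ∷ B)) (removeAt v j ∷ removeAt v j ∷ removeCol j B)
              λ { zero c → refl ; (suc zero) c → refl ; (suc (suc r)) c → refl }) ⟩
  sgn j * (u j * det (removeAt v j ∷ removeAt v j ∷ removeCol j B))
    ≡⟨ cong (λ d → sgn j * (u j * d)) (det-same-row₀₁ (removeAt v j) (removeCol j B)) ⟩
  sgn j * (u j * 0ℤ)
    ≡⟨ annihilate (sgn j) (u j) ⟩
  0ℤ ∎)
  where
  annihilate : ∀ s a → s * (a * 0ℤ) ≡ 0ℤ
  annihilate = solve-∀

det-subtract-row₂-from-row₁ : ∀ {n} (u v w : Vector ℤ (suc (suc (suc n)))) (B : Rows n (suc (suc (suc n)))) →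
                              det (u ∷ v ∷ w ∷ B) ≡ det (u ∷ zipWith _-_ v w ∷ w ∷ B)
det-subtract-row₂-from-row₁ u v w B = begin
  det (u ∷ v ∷ w ∷ B)
    ≡⟨ det-cong (u ∷ v ∷ w ∷ B) (u ∷ zipWith _+_ (zipWith _-_ v w) w ∷ w ∷ B)
         (λ { zero c → refl ; (suc zero) c → split (v c) (w c) ; (suc (suc r)) c → refl }) ⟩
  det (u ∷ zipWith _+_ (zipWith _-_ v w) w ∷ w ∷ B)
    ≡⟨ det-linear-row₁ u (zipWith _-_ v w) w (w ∷ B) ⟩
  det (u ∷ zipWith _-_ v w ∷ w ∷ B) + det (u ∷ w ∷ w ∷ B)
    ≡⟨ cong (_+_ (det (u ∷ zipWith _-_ v w ∷ w ∷ B))) (det-same-row₁₂ u w B) ⟩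
  det (u ∷ zipWith _-_ v w ∷ w ∷ B) + 0ℤ
    ≡⟨ +-identityʳ _ ⟩
  det (u ∷ zipWith _-_ v w ∷ w ∷ B) ∎
  where
  split : ∀ x y → x ≡ (x - y) + y
  split = solve-∀

det-expand-single : ∀ {n} (u : Vector ℤ (suc n)) (B : Rows n (suc n)) k → (∀ j → j ≢ k → u j ≡ 0ℤ) →
                    det (u ∷ B) ≡ sgn k * (u k * det (removeCol k B))
det-expand-single u B k u≗0 = begin
  det (u ∷ B)                      ≡⟨ det-expand u B ⟩
  sum T                            ≡⟨ sum-remove {i = k} T ⟩
  T k + sum (removeAt T k)         ≡⟨ cong (_+_ (T k)) (sum-zero (removeAt T k) vanish) ⟩
  T k + 0ℤ                         ≡⟨ +-identityʳ (T k) ⟩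
  T k                              ∎
  where
  T : Vector ℤ _
  T j = sgn j * (u j * det (removeCol j B))
  vanish : ∀ j → T (punchIn k j) ≡ 0ℤ
  vanish j = begin
    sgn (punchIn k j) * (u (punchIn k j) * M)
      ≡⟨ cong (λ x → sgn (punchIn k j) * (x * M)) (u≗0 (punchIn k j) (punchInᵢ≢i k j)) ⟩
    sgn (punchIn k j) * (0ℤ * M)
      ≡⟨ annihilate (sgn (punchIn k j)) M ⟩
    0ℤ ∎
    where
    M = det (removeCol (punchIn k j) B)
    annihilate : ∀ s d → s * (0ℤ * d) ≡ 0ℤ
    annihilate = solve-∀

det-expand-first3 : ∀ {n} (u : Vector ℤ (suc (suc (suc n)))) (B : Rows (suc (suc n)) (suc (suc (suc n)))) →
                    (∀ j → u (suc (suc (suc j))) ≡ 0ℤ) →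
                    det (u ∷ B) ≡ u zero * det (removeCol zero B) - u (suc zero) * det (removeCol (suc zero) B)
                                  + u (suc (suc zero)) * det (removeCol (suc (suc zero)) B)
det-expand-first3 u B u≗0 = begin
  det (u ∷ B)
    ≡⟨ det-expand u B ⟩
  T zero + (T (suc zero) + (T (suc (suc zero)) + sum (λ j → T (suc (suc (suc j))))))
    ≡⟨ cong (λ t → T zero + (T (suc zero) + (T (suc (suc zero)) + t))) (sum-zero _ vanish) ⟩
  T zero + (T (suc zero) + (T (suc (suc zero)) + 0ℤ))
    ≡⟨ expand (u zero) (u (suc zero)) (u (suc (suc zero))) (M zero) (M (suc zero)) (M (suc (suc zero))) ⟩
  u zero * M zero - u (suc zero) * M (suc zero) + u (suc (suc zero)) * M (suc (suc zero)) ∎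
  where
  M = λ j → det (removeCol j B)
  T = λ j → sgn j * (u j * M j)
  vanish : ∀ j → T (suc (suc (suc j))) ≡ 0ℤ
  vanish j = begin
    T (suc (suc (suc j)))
      ≡⟨ cong (λ x → sgn (suc (suc (suc j))) * (x * M (suc (suc (suc j))))) (u≗0 j) ⟩
    - - - sgn j * (0ℤ * M (suc (suc (suc j))))
      ≡⟨ annihilate (sgn j) (M (suc (suc (suc j)))) ⟩
    0ℤ ∎
    where
    annihilate : ∀ s d → - - - s * (0ℤ * d) ≡ 0ℤ
    annihilate = solve-∀
  expand : ∀ a b c x y z → 1ℤ * (a * x) + (- 1ℤ * (b * y) + (- - 1ℤ * (c * z) + 0ℤ)) ≡ a * x - b * y + c * z
  expand = solve-∀

-- In the small cases the left-hand sides below are det A with the Laplace sums unfolded.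
det-1×1 : ∀ (A : Matrix 1) → det A ≡ A zero zero
det-1×1 A = expand (A zero zero)
  where
  expand : ∀ a → 1ℤ * (a * 1ℤ) + 0ℤ ≡ a
  expand = solve-∀

det-2×2 : ∀ (A : Matrix 2) → det A ≡ A zero zero * A (suc zero) (suc zero) - A zero (suc zero) * A (suc zero) zero
det-2×2 A = expand (A zero zero) (A zero (suc zero)) (A (suc zero) zero) (A (suc zero) (suc zero))
  where
  expand : ∀ a b c d →
           1ℤ * (a * (1ℤ * (d * 1ℤ) + 0ℤ)) + (- 1ℤ * (b * (1ℤ * (c * 1ℤ) + 0ℤ)) + 0ℤ) ≡ a * d - b * c
  expand = solve-∀

det-add-entry₁₁ : ∀ {n} (u v : Vector ℤ (suc (suc n))) (B : Rows n (suc (suc n))) t →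
                  det (u ∷ zipWith _+_ v (0ℤ ∷ t ∷ λ _ → 0ℤ) ∷ B) ≡
                  det (u ∷ v ∷ B) + t * det (removeAt u (suc zero) ∷ removeCol (suc zero) B)
det-add-entry₁₁ u v B t = begin
  det (u ∷ zipWith _+_ v e ∷ B)
    ≡⟨ det-linear-row₁ u v e B ⟩
  det (u ∷ v ∷ B) + det (u ∷ e ∷ B)
    ≡⟨ cong (_+_ (det (u ∷ v ∷ B))) (det-swap-row₀₁ u e B) ⟩
  det (u ∷ v ∷ B) + - det (e ∷ u ∷ B)
    ≡⟨ cong (λ x → det (u ∷ v ∷ B) + - x) (det-expand-single e (u ∷ B) (suc zero) e-single) ⟩
  det (u ∷ v ∷ B) + - (-1ℤ * (t * det (removeCol (suc zero) (u ∷ B))))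
    ≡⟨ cong (λ x → det (u ∷ v ∷ B) + - (-1ℤ * (t * x))) (det-removeCol-∷ (suc zero) u B) ⟩
  det (u ∷ v ∷ B) + - (-1ℤ * (t * D))
    ≡⟨ simplify (det (u ∷ v ∷ B)) t D ⟩
  det (u ∷ v ∷ B) + t * D ∎
  where
  e = 0ℤ ∷ t ∷ λ _ → 0ℤ
  D = det (removeAt u (suc zero) ∷ removeCol (suc zero) B)
  e-single : ∀ j → j ≢ suc zero → e j ≡ 0ℤ
  e-single zero          _   = refl
  e-single (suc zero)    j≢1 = contradiction refl j≢1
  e-single (suc (suc j)) _   = refl
  simplify : ∀ x t d → x + - (-1ℤ * (t * d)) ≡ x + t * d
  simplify = solve-∀

-- Bordered transitive skew matrices

transitiveSkew : ∀ {n} → Matrix n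
transitiveSkew zero    zero    = 0ℤ
transitiveSkew zero    (suc j) = 1ℤ
transitiveSkew (suc i) zero    = -1ℤ
transitiveSkew (suc i) (suc j) = transitiveSkew i j

transitiveSkew-diag : ∀ {n} (i : Fin n) → transitiveSkew i i ≡ 0ℤ
transitiveSkew-diag zero    = refl
transitiveSkew-diag (suc i) = transitiveSkew-diag i

transitiveSkew-< : ∀ {n} {i j : Fin n} → i < j → transitiveSkew i j ≡ 1ℤ
transitiveSkew-< {i = zero}  {suc j} _         = refl
transitiveSkew-< {i = suc i} {suc j} (s≤s i<j) = transitiveSkew-< i<j

transitiveSkew-> : ∀ {n} {i j : Fin n} → j < i → transitiveSkew i j ≡ -1ℤ
transitiveSkew-> {i = suc i} {zero}  _         = refl
transitiveSkew-> {i = suc i} {suc j} (s≤s j<i) = transitiveSkew-> j<i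

bordered : ∀ {m} → ℤ → Vector ℤ m → Vector ℤ m → Matrix (suc m)
bordered c a b = (c ∷ a) ∷ λ i → b i ∷ transitiveSkew i

alt : ∀ {m} → Vector ℤ m → ℤ
alt {zero}  a = 0ℤ
alt {suc m} a = head a - alt (tail a)

alternatingForm : ∀ {m} → Vector ℤ m → Vector ℤ m → ℤ
alternatingForm {zero}  a b = 0ℤ
alternatingForm {suc m} a b = head a * alt (tail b) - head b * alt (tail a) + alternatingForm (tail a) (tail b)

BorderedFn : ℕ → Set
BorderedFn m = ℤ → Vector ℤ m → Vector ℤ m → ℤ

closedForm : ∀ {m} → Parity → BorderedFn m
closedForm 0ℙ c a b = c + alternatingForm a b
closedForm 1ℙ c a b = - (alt a * alt b)

detBordered : ∀ {m} → BorderedFn m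
detBordered c a b = det (bordered c a b)

recurrence : ∀ {m} → BorderedFn (suc m) → BorderedFn m → BorderedFn (suc (suc m))
recurrence D₁ D₀ c a b =
  (b (suc zero) - b zero) * D₁ (head a) (tail a) (λ _ → -1ℤ) + D₁ c (tail a) (tail b)
  - D₁ c (head a ∷ tail (tail a)) (tail b) + D₀ c (tail (tail a)) (tail (tail b))

-- Subtracting row 2 from row 1 leaves (b₀ - b₁, 1, 1, 0, …, 0); expand along it.  The minor at
-- column 2 is again bordered, except for a -1 in place of the 0 at position (1,1).
det-bordered-recurrence : ∀ {m} c (a b : Vector ℤ (suc (suc m))) →
                          detBordered c a b ≡ recurrence detBordered detBordered c a b
det-bordered-recurrence {m} c a b = begin
  det (bordered c a b)
    ≡⟨ det-cong (bordered c a b) (r₀ ∷ r₁ ∷ r₂ ∷ rest)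
         (λ { zero _ → refl ; (suc zero) _ → refl ; (suc (suc zero)) _ → refl ; (suc (suc (suc _))) _ → refl }) ⟩
  det (r₀ ∷ r₁ ∷ r₂ ∷ rest)
    ≡⟨ det-subtract-row₂-from-row₁ r₀ r₁ r₂ rest ⟩
  det (r₀ ∷ d ∷ r₂ ∷ rest)
    ≡⟨ det-swap-row₀₁ r₀ d (r₂ ∷ rest) ⟩
  - det (d ∷ r₀ ∷ r₂ ∷ rest)
    ≡⟨ cong -_ (det-expand-first3 d (r₀ ∷ r₂ ∷ rest) (λ _ → refl)) ⟩
  - (d zero * M zero - d (suc zero) * M (suc zero) + d (suc (suc zero)) * M (suc (suc zero)))
    ≡⟨ cong₂ (λ x y → - (d zero * x - d (suc zero) * M (suc zero) + d (suc (suc zero)) * y)) minor₀ minor₂ ⟩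
  - ((b zero - b (suc zero)) * D₀ - (0ℤ - -1ℤ) * M (suc zero) + (1ℤ - 0ℤ) * (P + -1ℤ * Q))
    ≡⟨ cong (λ y → - ((b zero - b (suc zero)) * D₀ - (0ℤ - -1ℤ) * y + (1ℤ - 0ℤ) * (P + -1ℤ * Q))) minor₁ ⟩
  - ((b zero - b (suc zero)) * D₀ - (0ℤ - -1ℤ) * D₁ + (1ℤ - 0ℤ) * (P + -1ℤ * Q))
    ≡⟨ simplify (b zero) (b (suc zero)) D₀ D₁ P Q ⟩
  recurrence detBordered detBordered c a b ∎
  where
  r₀ r₁ r₂ d : Vector ℤ (suc (suc (suc m)))
  r₀ = c ∷ a
  r₁ = b zero ∷ transitiveSkew zero
  r₂ = b (suc zero) ∷ transitiveSkew (suc zero)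
  d = zipWith _-_ r₁ r₂
  rest : Rows m (suc (suc (suc m)))
  rest i = b (suc (suc i)) ∷ transitiveSkew (suc (suc i))
  M : Fin (suc (suc (suc m))) → ℤ
  M j = det (removeCol j (r₀ ∷ r₂ ∷ rest))
  D₀ = detBordered (head a) (tail a) (λ _ → -1ℤ)
  D₁ = detBordered c (tail a) (tail b)
  P = detBordered c (head a ∷ tail (tail a)) (tail b)
  Q = detBordered c (tail (tail a)) (tail (tail b))
  minor₀ : M zero ≡ D₀
  minor₀ = det-cong (removeCol zero (r₀ ∷ r₂ ∷ rest)) (bordered (head a) (tail a) (λ _ → -1ℤ)) λ
    { zero zero → refl ; zero (suc _) → refl
    ; (suc zero) zero → refl ; (suc zero) (suc _) → refl
    ; (suc (suc _)) zero → refl ; (suc (suc _)) (suc _) → refl }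
  minor₁ : M (suc zero) ≡ D₁
  minor₁ = det-cong (removeCol (suc zero) (r₀ ∷ r₂ ∷ rest)) (bordered c (tail a) (tail b)) λ
    { zero zero → refl ; zero (suc _) → refl
    ; (suc zero) zero → refl ; (suc zero) (suc _) → refl
    ; (suc (suc _)) zero → refl ; (suc (suc _)) (suc _) → refl }
  minor₂ : M (suc (suc zero)) ≡ P + -1ℤ * Q
  minor₂ = begin
    M (suc (suc zero))
      ≡⟨ det-cong (removeCol (suc (suc zero)) (r₀ ∷ r₂ ∷ rest)) (B zero ∷ zipWith _+_ (B (suc zero)) e ∷ B₂)
           (λ { zero zero → refl ; zero (suc zero) → refl ; zero (suc (suc _)) → refl
              ; (suc zero) zero → sym (+-identityʳ _) ; (suc zero) (suc zero) → refl
              ; (suc zero) (suc (suc _)) → refl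
              ; (suc (suc _)) zero → refl ; (suc (suc _)) (suc zero) → refl ; (suc (suc _)) (suc (suc _)) → refl }) ⟩
    det (B zero ∷ zipWith _+_ (B (suc zero)) e ∷ B₂)
      ≡⟨ det-add-entry₁₁ (B zero) (B (suc zero)) B₂ -1ℤ ⟩
    det (B zero ∷ B (suc zero) ∷ B₂) + -1ℤ * det (removeAt (B zero) (suc zero) ∷ removeCol (suc zero) B₂)
      ≡⟨ cong₂ (λ x y → x + -1ℤ * y)
           (det-cong (B zero ∷ B (suc zero) ∷ B₂) B
              λ { zero _ → refl ; (suc zero) _ → refl ; (suc (suc _)) _ → refl })
           (det-cong (removeAt (B zero) (suc zero) ∷ removeCol (suc zero) B₂) (bordered c (tail (tail a)) (tail (tail b)))
              λ { zero zero → refl ; zero (suc _) → refl ; (suc _) zero → refl ; (suc _) (suc _) → refl }) ⟩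
    P + -1ℤ * Q ∎
    where
    B = bordered c (head a ∷ tail (tail a)) (tail b)
    B₂ = tail (tail B)
    e = 0ℤ ∷ -1ℤ ∷ λ _ → 0ℤ
  simplify : ∀ b₀ b₁ x y p q →
             - ((b₀ - b₁) * x - (0ℤ - -1ℤ) * y + (1ℤ - 0ℤ) * (p + -1ℤ * q)) ≡ (b₁ - b₀) * x + y - p + q
  simplify = solve-∀

recurrence-cong : ∀ {m} {D₁ E₁ : BorderedFn (suc m)} {D₀ E₀ : BorderedFn m} →
                  (∀ c a b → D₁ c a b ≡ E₁ c a b) → (∀ c a b → D₀ c a b ≡ E₀ c a b) →
                  ∀ c a b → recurrence D₁ D₀ c a b ≡ recurrence E₁ E₀ c a b
recurrence-cong D₁≗E₁ D₀≗E₀ c a b =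
  cong₂ _+_ (cong₂ _-_ (cong₂ _+_ (cong ((b (suc zero) - b zero) *_) (D₁≗E₁ _ _ _)) (D₁≗E₁ _ _ _))
                       (D₁≗E₁ _ _ _))
            (D₀≗E₀ _ _ _)

alt-const : ∀ {m} x → parity m ≡ 0ℙ → alt {m} (λ _ → x) ≡ 0ℤ
alt-const {zero}        x _    = refl
alt-const {suc (suc m)} x even = trans (cancel x (alt {m} (λ _ → x))) (alt-const {m} x even)
  where
  cancel : ∀ x a → x - (x - a) ≡ a
  cancel = solve-∀

alternatingForm-constʳ : ∀ {m} (a : Vector ℤ m) x → parity m ≡ 0ℙ → alternatingForm a (λ _ → x) ≡ x * alt a
alternatingForm-constʳ {zero}        a x _ = sym (*-zeroʳ x)
alternatingForm-constʳ {suc (suc m)} a x even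
  rewrite alt-const {m} x even | alternatingForm-constʳ (tail (tail a)) x even =
  expand (head a) (a (suc zero)) (alt (tail (tail a))) x
  where
  expand : ∀ a₀ a₁ α x →
           a₀ * (x - 0ℤ) - x * (a₁ - α) + (a₁ * 0ℤ - x * α + x * α) ≡ x * (a₀ - (a₁ - α))
  expand = solve-∀

parity-suc : ∀ m → parity (suc m) ≡ parity m ⁻¹
parity-suc m = sym (⁻¹-selfInverse (suc-homo-⁻¹ m))

closedForm-recurrence : ∀ {m} p → parity m ≡ p → ∀ c (a b : Vector ℤ (suc (suc m))) →
                        recurrence (closedForm (p ⁻¹)) (closedForm p) c a b ≡ closedForm p c a b
closedForm-recurrence {m} 0ℙ even c a b rewrite alt-const {m} -1ℤ even =
  expand (head a) (a (suc zero)) (alt (tail (tail a))) (head b) (b (suc zero)) (alt (tail (tail b)))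
         c (alternatingForm (tail (tail a)) (tail (tail b)))
  where
  expand : ∀ a₀ a₁ α b₀ b₁ β c F →
    (b₁ - b₀) * - ((a₁ - α) * (-1ℤ - 0ℤ)) + - ((a₁ - α) * (b₁ - β)) - - ((a₀ - α) * (b₁ - β)) + (c + F)
    ≡ c + (a₀ * (b₁ - β) - b₀ * (a₁ - α) + (a₁ * β - b₁ * α + F))
  expand = solve-∀
closedForm-recurrence {m} 1ℙ odd c a b
  rewrite alternatingForm-constʳ (tail a) -1ℤ (trans (parity-suc m) (cong _⁻¹ odd)) =
  expand (head a) (a (suc zero)) (alt (tail (tail a))) (head b) (b (suc zero)) (alt (tail (tail b)))
         c (alternatingForm (tail (tail a)) (tail (tail b)))
  where
  expand : ∀ a₀ a₁ α b₀ b₁ β c F →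
    (b₁ - b₀) * (a₀ + -1ℤ * (a₁ - α)) + (c + (a₁ * β - b₁ * α + F)) - (c + (a₀ * β - b₁ * α + F)) + - (α * β)
    ≡ - ((a₀ - (a₁ - α)) * (b₀ - (b₁ - β)))
  expand = solve-∀

det-bordered : ∀ m c (a b : Vector ℤ m) → detBordered c a b ≡ closedForm (parity m) c a b
det-bordered zero          c a b = trans (det-1×1 (bordered c a b)) (sym (+-identityʳ c))
det-bordered (suc zero)    c a b = trans (det-2×2 (bordered c a b)) (expand c (a zero) (b zero))
  where
  expand : ∀ c x y → c * 0ℤ - x * y ≡ - ((x - 0ℤ) * (y - 0ℤ))
  expand = solve-∀
det-bordered (suc (suc m)) c a b = begin
  detBordered c a b
    ≡⟨ det-bordered-recurrence c a b ⟩
  recurrence detBordered detBordered c a b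
    ≡⟨ recurrence-cong
         (λ c a b → trans (det-bordered (suc m) c a b) (cong (λ p → closedForm p c a b) (parity-suc m)))
         (det-bordered m) c a b ⟩
  recurrence (closedForm (parity m ⁻¹)) (closedForm (parity m)) c a b
    ≡⟨ closedForm-recurrence (parity m) refl c a b ⟩
  closedForm (parity m) c a b ∎

alt-cong : ∀ {m} {a b : Vector ℤ m} → (∀ i → a i ≡ b i) → alt a ≡ alt b
alt-cong {zero}  a≗b = refl
alt-cong {suc m} a≗b = cong₂ _-_ (a≗b zero) (alt-cong (a≗b ∘ suc))

alt-neg : ∀ {m} (a : Vector ℤ m) → alt (map -_ a) ≡ - alt a
alt-neg {zero}  a = refl
alt-neg {suc m} a = trans (cong (_-_ (- head a)) (alt-neg (tail a))) (neg-distrib (head a) (alt (tail a)))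
  where
  neg-distrib : ∀ x y → - x - - y ≡ - (x - y)
  neg-distrib = solve-∀

alt-sgn : ∀ m → alt {m} sgn ≡ + m
alt-sgn zero    = refl
alt-sgn (suc m) = begin
  1ℤ - alt {m} (map -_ sgn) ≡⟨ cong (_-_ 1ℤ) (alt-neg {m} sgn) ⟩
  1ℤ - - alt {m} sgn        ≡⟨ cong (λ x → 1ℤ - - x) (alt-sgn m) ⟩
  1ℤ - - + m                ≡⟨ cong (_+_ 1ℤ) (neg-involutive (+ m)) ⟩
  + suc m                   ∎

alternatingForm-skew : ∀ {m} (a : Vector ℤ m) → alternatingForm a (map -_ a) ≡ 0ℤ
alternatingForm-skew {zero}  a = refl
alternatingForm-skew {suc m} a
  rewrite alt-neg (tail a) | alternatingForm-skew (tail a) = cancel (head a) (alt (tail a))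
  where
  cancel : ∀ x α → x * - α - - x * α + 0ℤ ≡ 0ℤ
  cancel = solve-∀

closedForm-skew-even : ∀ {m} (a : Vector ℤ m) → closedForm 0ℙ 0ℤ a (map -_ a) ≡ 0ℤ
closedForm-skew-even a = trans (+-identityˡ _) (alternatingForm-skew a)

closedForm-skew-odd : ∀ {m} (a : Vector ℤ m) → closedForm 1ℙ 0ℤ a (map -_ a) ≡ alt a * alt a
closedForm-skew-odd a = trans (cong (λ x → - (alt a * x)) (alt-neg a)) (square (alt a))
  where
  square : ∀ x → - (x * - x) ≡ x * x
  square = solve-∀

-- Alternating sums of signs

boolSign : Bool → ℤ
boolSign true  = 1ℤ
boolSign false = -1ℤ

boolSign-not : ∀ b → boolSign (not b) ≡ - boolSign b
boolSign-not true  = refl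
boolSign-not false = refl

OddUpTo : ℕ → ℤ → Set
OddUpTo m s = Σ ℕ λ q → Odd q × q ≤ m × (s ≡ + q ⊎ s ≡ - + q)

odd-2+ : ∀ j → suc (2 ℕ.* suc j) ≡ 2 ℕ.+ suc (2 ℕ.* j)
odd-2+ j = cong (λ n → suc (suc n)) (+-suc j (j ℕ.+ 0))

OddUpTo-neg : ∀ {m s} → OddUpTo m s → OddUpTo m (- s)
OddUpTo-neg (q , odd , q≤m , inj₁ refl) = q , odd , q≤m , inj₂ refl
OddUpTo-neg (q , odd , q≤m , inj₂ refl) = q , odd , q≤m , inj₁ (neg-involutive (+ q))

OddUpTo-weaken : ∀ {m n s} → m ≤ n → OddUpTo m s → OddUpTo n s
OddUpTo-weaken m≤n (q , odd , q≤m , s≡±q) = q , odd , ≤-trans q≤m m≤n , s≡±q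

OddUpTo-2+ : ∀ {m s} → OddUpTo m s → OddUpTo (2 ℕ.+ m) (+ 2 + s)
OddUpTo-2+ (q , (j , refl) , q≤m , inj₁ refl) =
  2 ℕ.+ q , (suc j , sym (odd-2+ j)) , s≤s (s≤s q≤m) , inj₁ refl
OddUpTo-2+ (_ , (zero , refl) , _ , inj₂ refl) = 1 , (0 , refl) , s≤s z≤n , inj₁ refl
OddUpTo-2+ {m} (_ , (suc j , refl) , q≤m , inj₂ refl) =
  suc (2 ℕ.* j) , (j , refl) ,
  ≤-trans (m≤n+m _ 2) (≤-trans (≤-reflexive (sym (odd-2+ j))) (≤-trans q≤m (m≤n+m m 2))) ,
  inj₂ (trans (cong (λ n → + 2 + - + n) (odd-2+ j)) (cancel (+ suc (2 ℕ.* j))))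
  where
  cancel : ∀ x → + 2 + - (+ 2 + x) ≡ - x
  cancel = solve-∀

OddUpTo-step : ∀ {m s} x y → OddUpTo m s → OddUpTo (2 ℕ.+ m) (boolSign x - (boolSign y - s))
OddUpTo-step {m} {s} true  true  h = subst (OddUpTo _) (sym (same s)) (OddUpTo-weaken (m≤n+m m 2) h)
  where
  same : ∀ s → 1ℤ - (1ℤ - s) ≡ s
  same = solve-∀
OddUpTo-step {m} {s} false false h = subst (OddUpTo _) (sym (same s)) (OddUpTo-weaken (m≤n+m m 2) h)
  where
  same : ∀ s → -1ℤ - (-1ℤ - s) ≡ s
  same = solve-∀
OddUpTo-step {m} {s} true  false h = subst (OddUpTo _) (sym (up s)) (OddUpTo-2+ h)
  where
  up : ∀ s → 1ℤ - (-1ℤ - s) ≡ + 2 + s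
  up = solve-∀
OddUpTo-step {m} {s} false true  h = subst (OddUpTo _) (sym (down s)) (OddUpTo-neg (OddUpTo-2+ (OddUpTo-neg h)))
  where
  down : ∀ s → -1ℤ - (1ℤ - s) ≡ - (+ 2 + - s)
  down = solve-∀

alt-signs : ∀ {m} (f : Vector Bool m) → parity m ≡ 1ℙ → OddUpTo m (alt (map boolSign f))
alt-signs {suc zero} f _ with f zero
... | true  = 1 , (0 , refl) , ≤-refl , inj₁ refl
... | false = 1 , (0 , refl) , ≤-refl , inj₂ refl
alt-signs {suc (suc m)} f odd = OddUpTo-step (f zero) (f (suc zero)) (alt-signs (tail (tail f)) odd)

skew-diag : ∀ {n} (T : Tournament n) i → skew T i i ≡ 0ℤ
skew-diag T i with arc T i i | irrefl T i
... | false | _ = refl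

skew-offDiag : ∀ {n} (T : Tournament n) {i j} → i ≢ j → skew T i j ≡ boolSign (arc T i j)
skew-offDiag T {i} {j} i≢j with arc T i j | arc T j i | exactlyOne T i j i≢j
... | true  | _    | _  = refl
... | false | true | _  = refl
... | false | false | ()

apexSigns : ∀ {m} → Tournament (suc m) → Vector ℤ m
apexSigns T j = boolSign (arc T zero (suc j))

skew-bordered : ∀ {m} (T : Tournament (suc m)) → (∀ {i j} → i < j → arc T (suc i) (suc j) ≡ true) →
                ∀ r c → skew T r c ≡ bordered 0ℤ (apexSigns T) (map -_ (apexSigns T)) r c
skew-bordered T transitive zero    zero    = skew-diag T zero
skew-bordered T transitive zero    (suc j) = skew-offDiag T λ ()
skew-bordered T transitive (suc i) zero    = begin
  skew T (suc i) zero                  ≡⟨ skew-offDiag T (λ ()) ⟩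
  boolSign (arc T (suc i) zero)        ≡⟨ cong boolSign (exactlyOne T zero (suc i) λ ()) ⟩
  boolSign (not (arc T zero (suc i)))  ≡⟨ boolSign-not _ ⟩
  - apexSigns T i                      ∎
skew-bordered T transitive (suc i) (suc j) with <-cmp i j
... | tri< i<j i≢j _ = begin
  skew T (suc i) (suc j)               ≡⟨ skew-offDiag T (i≢j ∘ suc-injective) ⟩
  boolSign (arc T (suc i) (suc j))     ≡⟨ cong boolSign (transitive i<j) ⟩
  1ℤ                                   ≡⟨ transitiveSkew-< i<j ⟨
  transitiveSkew i j                   ∎
... | tri≈ _ refl _ = trans (skew-diag T (suc i)) (sym (transitiveSkew-diag i))
... | tri> _ i≢j j<i = begin
  skew T (suc i) (suc j)               ≡⟨ skew-offDiag T (i≢j ∘ suc-injective) ⟩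
  boolSign (arc T (suc i) (suc j))     ≡⟨ cong boolSign (exactlyOne T (suc j) (suc i) (i≢j ∘ sym ∘ suc-injective)) ⟩
  boolSign (not (arc T (suc j) (suc i))) ≡⟨ cong (boolSign ∘ not) (transitive j<i) ⟩
  -1ℤ                                  ≡⟨ transitiveSkew-> j<i ⟨
  transitiveSkew i j                   ∎

detT-bordered : ∀ {m} (T : Tournament (suc m)) → (∀ {i j} → i < j → arc T (suc i) (suc j) ≡ true) →
                detT T ≡ closedForm (parity m) 0ℤ (apexSigns T) (map -_ (apexSigns T))
detT-bordered {m} T transitive =
  trans (det-cong (skew T) (bordered 0ℤ (apexSigns T) (map -_ (apexSigns T))) (skew-bordered T transitive))
        (det-bordered m 0ℤ (apexSigns T) (map -_ (apexSigns T)))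

-- The apex tournament

precedes : ∀ {n} → Fin n → Fin n → Bool
precedes zero    zero    = false
precedes zero    (suc _) = true
precedes (suc _) zero    = false
precedes (suc i) (suc j) = precedes i j

precedes-irrefl : ∀ {n} (i : Fin n) → precedes i i ≡ false
precedes-irrefl zero    = refl
precedes-irrefl (suc i) = precedes-irrefl i

precedes-flip : ∀ {n} (i j : Fin n) → i ≢ j → precedes j i ≡ not (precedes i j)
precedes-flip zero    zero    i≢j = contradiction refl i≢j
precedes-flip zero    (suc j) _   = refl
precedes-flip (suc i) zero    _   = refl
precedes-flip (suc i) (suc j) i≢j = precedes-flip i j (i≢j ∘ cong suc)

precedes-< : ∀ {n} {i j : Fin n} → i < j → precedes i j ≡ true
precedes-< {i = zero}  {suc j} _         = refl
precedes-< {i = suc i} {suc j} (s≤s i<j) = precedes-< i<j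

isEven : ∀ {n} → Fin n → Bool
isEven zero    = true
isEven (suc j) = not (isEven j)

boolSign-isEven : ∀ {n} (j : Fin n) → boolSign (isEven j) ≡ sgn j
boolSign-isEven zero    = refl
boolSign-isEven (suc j) = trans (boolSign-not (isEven j)) (cong -_ (boolSign-isEven j))

isEven-inject≤ : ∀ {m n} (j : Fin m) .(m≤n : m ≤ n) → isEven (inject≤ j m≤n) ≡ isEven j
isEven-inject≤ {n = suc n} zero    _    = refl
isEven-inject≤ {n = suc n} (suc j) m≤n = cong not (isEven-inject≤ j (s≤s⁻¹ m≤n))

apexArc : ∀ {k} → Fin (suc k) → Fin (suc k) → Bool
apexArc zero    zero    = false
apexArc zero    (suc j) = isEven j
apexArc (suc i) zero    = not (isEven i)
apexArc (suc i) (suc j) = precedes i j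

apexTournament : ∀ k → Tournament (suc k)
apexTournament k = record { arc = apexArc ; irrefl = irrefl′ ; exactlyOne = exactlyOne′ }
  where
  irrefl′ : ∀ i → apexArc i i ≡ false
  irrefl′ zero    = refl
  irrefl′ (suc i) = precedes-irrefl i
  exactlyOne′ : ∀ i j → i ≢ j → apexArc j i ≡ not (apexArc i j)
  exactlyOne′ zero    zero    i≢j = contradiction refl i≢j
  exactlyOne′ zero    (suc j) _   = refl
  exactlyOne′ (suc i) zero    _   = sym (not-involutive (isEven i))
  exactlyOne′ (suc i) (suc j) i≢j = precedes-flip i j (i≢j ∘ cong suc)

apexArc-transitive : ∀ {k} {u v : Fin (suc k)} → zero {n = k} < u → u < v → apexArc u v ≡ true
apexArc-transitive {u = suc _} {suc _} _ (s≤s u<v) = precedes-< u<v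

induced-transitive : ∀ {k m} (S : VertexSubset (suc k) (suc m)) {i j} → i < j →
                     arc (induced (apexTournament k) S) (suc i) (suc j) ≡ true
induced-transitive S {i} {j} i<j = apexArc-transitive
  (≤-trans (s≤s z≤n) (increasing S zero (suc i) (s≤s z≤n))) (increasing S (suc i) (suc j) (s≤s i<j))

initialSegment : ∀ {k m} → m ≤ k → VertexSubset (suc k) (suc m)
initialSegment m≤k = record { elem = λ i → inject≤ i (s≤s m≤k) ; increasing = increasing′ }
  where
  increasing′ : ∀ i j → i < j → inject≤ i (s≤s m≤k) < inject≤ j (s≤s m≤k)
  increasing′ i j i<j rewrite toℕ-inject≤ i (s≤s m≤k) | toℕ-inject≤ j (s≤s m≤k) = i<j

OddSquareUpTo : ℕ → ℤ → Set
OddSquareUpTo k z = Σ ℕ λ m → Odd m × 1 ≤ m × m ≤ k × z ≡ + (m ℕ.* m)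

OddUpTo-square : ∀ {m k s} → OddUpTo m s → m ≤ k → OddSquareUpTo k (s * s)
OddUpTo-square (q , odd@(_ , refl) , q≤m , inj₁ refl) m≤k =
  q , odd , s≤s z≤n , ≤-trans q≤m m≤k , sym (pos-* q q)
OddUpTo-square (q , odd@(_ , refl) , q≤m , inj₂ refl) m≤k =
  q , odd , s≤s z≤n , ≤-trans q≤m m≤k , trans (neg-cancel (+ q) (+ q)) (sym (pos-* q q))
  where
  neg-cancel : ∀ x y → - x * - y ≡ x * y
  neg-cancel = solve-∀

parity-odd : ∀ {m} → Odd m → parity m ≡ 1ℙ
parity-odd (j , refl) = trans (parity-suc (2 ℕ.* j)) (cong _⁻¹ (*-homo-* 2 j))

subtournament-det : ∀ {k m} (S : VertexSubset (suc k) (suc m)) → let T = induced (apexTournament k) S in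
                    detT T ≡ 0ℤ ⊎ OddSquareUpTo k (detT T)
subtournament-det {k} {m} S = classify (parity m) refl
  where
  T = induced (apexTournament k) S
  ε = apexSigns T
  classify : ∀ p → parity m ≡ p → detT T ≡ 0ℤ ⊎ OddSquareUpTo k (detT T)
  classify 0ℙ even = inj₁ (begin
    detT T                                ≡⟨ detT-bordered T (induced-transitive S) ⟩
    closedForm (parity m) 0ℤ ε (map -_ ε) ≡⟨ cong (λ p → closedForm p 0ℤ ε (map -_ ε)) even ⟩
    closedForm 0ℙ 0ℤ ε (map -_ ε)        ≡⟨ closedForm-skew-even ε ⟩
    0ℤ                                    ∎)
  classify 1ℙ odd = inj₂ (subst (OddSquareUpTo k) (sym (begin
    detT T                                ≡⟨ detT-bordered T (induced-transitive S) ⟩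
    closedForm (parity m) 0ℤ ε (map -_ ε) ≡⟨ cong (λ p → closedForm p 0ℤ ε (map -_ ε)) odd ⟩
    closedForm 1ℙ 0ℤ ε (map -_ ε)        ≡⟨ closedForm-skew-odd ε ⟩
    alt ε * alt ε                         ∎))
    (OddUpTo-square (alt-signs (λ j → arc T zero (suc j)) odd) (s≤s⁻¹ (injective⇒≤ (elem-inj S _ _)))))

initialSegment-det : ∀ {k m} (m≤k : m ≤ k) → Odd m →
                     detT (induced (apexTournament k) (initialSegment m≤k)) ≡ + (m ℕ.* m)
initialSegment-det {k} {m} m≤k odd = begin
  detT T                                ≡⟨ detT-bordered T (induced-transitive (initialSegment m≤k)) ⟩
  closedForm (parity m) 0ℤ ε (map -_ ε) ≡⟨ cong (λ p → closedForm p 0ℤ ε (map -_ ε)) (parity-odd odd) ⟩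
  closedForm 1ℙ 0ℤ ε (map -_ ε)        ≡⟨ closedForm-skew-odd ε ⟩
  alt ε * alt ε                         ≡⟨ cong (λ x → x * x) (trans (alt-cong ε≗sgn) (alt-sgn m)) ⟩
  + m * + m                             ≡⟨ pos-* m m ⟨
  + (m ℕ.* m)                           ∎
  where
  T = induced (apexTournament k) (initialSegment m≤k)
  ε = apexSigns T
  ε≗sgn : ∀ j → ε j ≡ sgn j
  ε≗sgn j = trans (cong boolSign (isEven-inject≤ j _)) (boolSign-isEven j)

theorem4p7 : (k : ℕ) → 1 ≤ k → Odd k →
    Σ ℕ (λ n → Σ (Tournament n) (λ T → (z : ℤ) →
    (InM T z → (z ≡ + 0 ⊎ Σ ℕ (λ m → Odd m × 1 ≤ m × m ≤ k × z ≡ + (m ℕ.* m))))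
    × ((z ≡ + 0 ⊎ Σ ℕ (λ m → Odd m × 1 ≤ m × m ≤ k × z ≡ + (m ℕ.* m))) → InM T z)))
theorem4p7 k _ _ = suc k , apexTournament k , λ z → determinants z , realised z
  where
  determinants : ∀ z → InM (apexTournament k) z → z ≡ 0ℤ ⊎ OddSquareUpTo k z
  determinants _ (m , S , refl) = subtournament-det S
  vertex₀ : VertexSubset (suc k) 1
  vertex₀ = initialSegment z≤n
  realised : ∀ z → z ≡ 0ℤ ⊎ OddSquareUpTo k z → InM (apexTournament k) z
  realised _ (inj₁ refl) = 0 , vertex₀ , detT-bordered (induced (apexTournament k) vertex₀) (induced-transitive vertex₀)
  realised _ (inj₂ (m , odd , _ , m≤k , refl)) = m , initialSegment m≤k , initialSegment-det m≤k odd
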